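{- Let $G$ be a graph with $m\ge 1$ edges and maximum degree $\Delta$, and let $E'\subseteq E(G)$ be a set of edges such that the graph $G\setminus E'$ (obtained by deleting the edges in $E'$) has treewidth at most $t$. Then \[ q^*(G)\ge 1-2\left(\frac{(t+1)\Delta}{m}\right)^{1/2}-\frac{|E'|}{m}. \]
   Context: For a graph $G$ with $m\ge 1$ edges and a partition $\mathcal A$ of $V(G)$, $q_{\mathcal A}(G)=\frac1m\sum_{A\in\mathcal A} e(A) - \frac{1}{4m^2}\sum_{A\in\mathcal A}\mathrm{vol}(A)^2$, where $e(A)$ is the number of edges inside $A$ and $\mathrm{vol}(A)$ the sum of degrees of vertices in $A$; the modularity is $q^*(G)=\max_{\mathcal A} q_{\mathcal A}(G)$. Graphs are simple; treewidth is the usual notion (minimum over tree-decompositions of the maximum bag size minus one). -}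

module Defs where

open import Data.Nat using (ℕ; zero; suc; _+_; _*_; _≤_; _<ᵇ_; _⊔_; NonZero)
open import Data.Bool using (Bool; true; false; _∧_; not; if_then_else_)
open import Data.Fin using (Fin; zero; suc; toℕ; _≟_)
open import Data.Product using (∃; _×_)
open import Relation.Binary.PropositionalEquality using (_≡_)
open import Relation.Nullary using (does)
open import Data.Integer using (+_)
open import Data.Rational using (ℚ; _/_; 0ℚ; 1ℚ) renaming (_+_ to _+ℚ_; _*_ to _*ℚ_; _-_ to _-ℚ_; _≤_ to _≤ℚ_)
open import Data.Sum using (_⊎_)

sumFin : ∀ {n} → (Fin n → ℕ) → ℕ
sumFin {zero}  f = 0
sumFin {suc n} f = f zero + sumFin (λ i → f (suc i))

maxFin : ∀ {n} → (Fin n → ℕ) → ℕ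
maxFin {zero}  f = 0
maxFin {suc n} f = f zero ⊔ maxFin (λ i → f (suc i))

b2n : Bool → ℕ
b2n true  = 1
b2n false = 0

card : ∀ {n} → (Fin n → Bool) → ℕ
card S = sumFin (λ i → b2n (S i))

record Graph (n : ℕ) : Set where
  field
    adj    : Fin n → Fin n → Bool
    sym    : ∀ i j → adj i j ≡ adj j i
    irrefl : ∀ i → adj i i ≡ false
open Graph public

edgesIn : ∀ {n} → (Fin n → Fin n → Bool) → (Fin n → Bool) → ℕ
edgesIn a S = sumFin (λ i → sumFin (λ j →
  b2n (S i ∧ S j ∧ a i j ∧ (toℕ i <ᵇ toℕ j))))

numEdges : ∀ {n} → (Fin n → Fin n → Bool) → ℕ
numEdges a = edgesIn a (λ _ → true)

degree : ∀ {n} → (Fin n → Fin n → Bool) → Fin n → ℕ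
degree a i = sumFin (λ j → b2n (a i j))

maxDegree : ∀ {n} → (Fin n → Fin n → Bool) → ℕ
maxDegree a = maxFin (degree a)

vol : ∀ {n} → (Fin n → Fin n → Bool) → (Fin n → Bool) → ℕ
vol a S = sumFin (λ i → if S i then degree a i else 0)

deleteEdges : ∀ {n} → (Fin n → Fin n → Bool) → (Fin n → Fin n → Bool) → (Fin n → Fin n → Bool)
deleteEdges a E' i j = a i j ∧ not (E' i j)

-- Partitions, given by a labelling c : Fin n → Fin k; part a = c⁻¹(a).
-- (Empty labels contribute 0 to both sums, so this ranges over all partitions.)

part : ∀ {n k} → (Fin n → Fin k) → Fin k → Fin n → Bool
part c a v = does (c v ≟ a)

modularityOf : ∀ {n k} (G : Graph n) → {{_ : NonZero (numEdges (adj G))}} →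
               (Fin n → Fin k) → ℚ
modularityOf {k = k} G c =
  (r *ℚ (+ sumFin (λ a → edgesIn (adj G) (part c a)) / 1))
  -ℚ ((+ 1 / 4) *ℚ r *ℚ r *ℚ (+ sumFin (λ a → vol (adj G) (part c a) * vol (adj G) (part c a)) / 1))
  where r = + 1 / numEdges (adj G)

-- A tree on nodes Fin (suc p) is given by a parent function: node (suc i)
-- has parent `parent i` with index ≤ i (every finite tree admits such a
-- labelling, e.g. BFS order; treewidth is invariant under relabelling).

data TreeEdge {p : ℕ} (parent : Fin p → Fin (suc p)) : Fin (suc p) → Fin (suc p) → Set where
  up   : ∀ i → TreeEdge parent (suc i) (parent i)
  down : ∀ i → TreeEdge parent (parent i) (suc i)

data PathIn {q : ℕ} (R : Fin q → Fin q → Set) (S : Fin q → Set) : Fin q → Fin q → Set where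
  here : ∀ {x} → S x → PathIn R S x x
  step : ∀ {x y z} → S x → R x y → PathIn R S y z → PathIn R S x z

record TreeDecomposition {n : ℕ} (a : Fin n → Fin n → Bool) (t : ℕ) : Set where
  field
    p         : ℕ
    parent    : Fin p → Fin (suc p)
    parent-lt : ∀ i → toℕ (parent i) ≤ toℕ i
    bag       : Fin (suc p) → Fin n → Bool
    bag-size  : ∀ x → card (bag x) ≤ suc t
    cover-v   : ∀ v → ∃ λ x → bag x v ≡ true
    cover-e   : ∀ u v → a u v ≡ true → ∃ λ x → (bag x u ≡ true) × (bag x v ≡ true)
    subtree   : ∀ v x y → bag x v ≡ true → bag y v ≡ true →
                PathIn (TreeEdge parent) (λ z → bag z v ≡ true) x y

TreewidthAtMost : ∀ {n} → (Fin n → Fin n → Bool) → ℕ → Set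
TreewidthAtMost a t = TreeDecomposition a t

-- "D ≤ 2·√x" for rationals D and x ≥ 0, without real numbers:
-- D ≤ 2√x  ⇔  D ≤ 0  or  D² ≤ 4x.
LeTwoSqrt : ℚ → ℚ → Set
LeTwoSqrt D x = (D ≤ℚ 0ℚ) ⊎ ((D *ℚ D) ≤ℚ ((+ 4 / 1) *ℚ x))

-- Take a tree decomposition of G \ E' with bags of size ≤ t+1 and a threshold L ≈ √(4(t+1)Δm).
-- Sweeping the decomposition tree from the leaves upwards, cut a node as soon as the total degree of
-- the not yet grouped vertices whose topmost bag lies below it reaches L+1.  Vertices whose topmost
-- bag is cut become singletons; the others are grouped by the branch of the cut tree containing their
-- topmost bag.  Every part has volume ≤ L, so the degree tax Σ vol(A)²/4m² is at most L/2m; at most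
-- 2m/(L+1) nodes are cut, and an edge of G \ E' between two parts has an endpoint in a cut bag, so at
-- most (2m/(L+1))(t+1)Δ edges of G \ E' cross.  With this choice of L both losses are ≤ √((t+1)Δ/m).

module Submission where

open import Defs hiding (sym)
open import Data.Nat using (ℕ; zero; suc; _+_; _*_; _∸_; _≤_; _<_; _<ᵇ_; z≤n; s≤s; NonZero)
open import Data.Nat.Properties hiding (_≟_; 0≢1+n; suc-injective)
open import Data.Nat.Properties using () renaming (_≟_ to _≟ℕ_)
import Data.Nat.Solver as ℕSolver
open import Data.Bool using (Bool; true; false; _∧_; not; if_then_else_)
open import Data.Fin as Fin using (Fin; zero; suc; toℕ; _≟_; _↑ˡ_; _↑ʳ_; splitAt)
open import Data.Fin.Properties
  using (toℕ-injective; toℕ<n; suc-injective; ↑ˡ-injective; ↑ʳ-injective;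
         splitAt-↑ˡ; splitAt-↑ʳ; splitAt⁻¹-↑ˡ; splitAt⁻¹-↑ʳ; 0≢1+n)
open import Data.Product using (∃; Σ; _×_; _,_; proj₁; proj₂; map₂)
open import Data.Sum using (_⊎_; inj₁; inj₂; swap)
open import Function using (_∘_; mk⇔)
open import Relation.Nullary using (Dec; yes; no; does; contradiction)
open import Relation.Nullary.Decidable using (dec-true; dec-false; does-⇔)
open import Relation.Binary.PropositionalEquality
open import Relation.Binary.Definitions using (tri<; tri≈; tri>)
open import Algebra.Properties.CommutativeSemigroup +-commutativeSemigroup
  using () renaming (interchange to +-interchange)
open import Algebra.Properties.CommutativeSemigroup *-commutativeSemigroup
  using () renaming (x∙yz≈y∙xz to *-left-comm)

open import Data.Integer as ℤ using (+_)
import Data.Integer.Properties as ℤₚ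
open import Data.Rational as ℚ
  using (ℚ; 0ℚ; 1ℚ; _/_; fromℚᵘ)
  renaming (_+_ to _+ℚ_; _*_ to _*ℚ_; _-_ to _-ℚ_; -_ to -ℚ_; _≤_ to _≤ℚ_)
import Data.Rational.Properties as ℚₚ
open import Data.Rational.Unnormalised using (mkℚᵘ; *≡*; *≤*)
  renaming (_+_ to _+ᵘ_; _*_ to _*ᵘ_)
import Data.Rational.Unnormalised.Properties as ℚᵘₚ
import Data.Rational.Solver as ℚSolver

sumFin-cong : ∀ {n} {f g : Fin n → ℕ} → (∀ i → f i ≡ g i) → sumFin f ≡ sumFin g
sumFin-cong {zero}  f≡g = refl
sumFin-cong {suc n} f≡g = cong₂ _+_ (f≡g zero) (sumFin-cong (f≡g ∘ suc))

sumFin-mono : ∀ {n} {f g : Fin n → ℕ} → (∀ i → f i ≤ g i) → sumFin f ≤ sumFin g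
sumFin-mono {zero}  f≤g = z≤n
sumFin-mono {suc n} f≤g = +-mono-≤ (f≤g zero) (sumFin-mono (f≤g ∘ suc))

sumFin-zero : ∀ {n} → sumFin {n} (λ _ → 0) ≡ 0
sumFin-zero {zero}  = refl
sumFin-zero {suc n} = sumFin-zero {n}

sumFin-+ : ∀ {n} (f g : Fin n → ℕ) → sumFin (λ i → f i + g i) ≡ sumFin f + sumFin g
sumFin-+ {zero}  f g = refl
sumFin-+ {suc n} f g =
  trans (cong (_+_ (f zero + g zero)) (sumFin-+ (f ∘ suc) (g ∘ suc)))
        (+-interchange (f zero) (g zero) (sumFin (f ∘ suc)) (sumFin (g ∘ suc)))

sumFin-*ˡ : ∀ {n} k (f : Fin n → ℕ) → sumFin (λ i → k * f i) ≡ k * sumFin f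
sumFin-*ˡ {zero}  k f = sym (*-zeroʳ k)
sumFin-*ˡ {suc n} k f =
  trans (cong (_+_ (k * f zero)) (sumFin-*ˡ k (f ∘ suc))) (sym (*-distribˡ-+ k (f zero) _))

sumFin-*ʳ : ∀ {n} k (f : Fin n → ℕ) → sumFin (λ i → f i * k) ≡ sumFin f * k
sumFin-*ʳ k f = trans (sumFin-cong (λ i → *-comm (f i) k)) (trans (sumFin-*ˡ k f) (*-comm k _))

sumFin-swap : ∀ {n m} (f : Fin n → Fin m → ℕ) →
  sumFin (λ i → sumFin (λ j → f i j)) ≡ sumFin (λ j → sumFin (λ i → f i j))
sumFin-swap {zero}  {m} f = sym (sumFin-zero {m})
sumFin-swap {suc n} f =
  trans (cong (_+_ (sumFin (f zero))) (sumFin-swap (f ∘ suc)))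
        (sym (sumFin-+ (f zero) (λ j → sumFin (λ i → f (suc i) j))))

sumFin₂-+ : ∀ {n m} (f g : Fin n → Fin m → ℕ) →
  sumFin (λ i → sumFin (λ j → f i j + g i j))
    ≡ sumFin (λ i → sumFin (f i)) + sumFin (λ i → sumFin (g i))
sumFin₂-+ f g =
  trans (sumFin-cong (λ i → sumFin-+ (f i) (g i))) (sumFin-+ (sumFin ∘ f) (sumFin ∘ g))

sumFin-swap₃ : ∀ {n m r} (f : Fin n → Fin m → Fin r → ℕ) →
  sumFin (λ i → sumFin (λ j → sumFin (f i j)))
    ≡ sumFin (λ x → sumFin (λ i → sumFin (λ j → f i j x)))
sumFin-swap₃ f =
  trans (sumFin-cong (sumFin-swap ∘ f)) (sumFin-swap (λ i x → sumFin (λ j → f i j x)))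

sumFin₂-*-sumFin : ∀ {n m r} (e : Fin n → Fin m → ℕ) (s : Fin r → ℕ)
  (h : Fin r → Fin n → Fin m → ℕ) →
  sumFin (λ i → sumFin (λ j → e i j * sumFin (λ x → s x * h x i j)))
    ≡ sumFin (λ x → s x * sumFin (λ i → sumFin (λ j → e i j * h x i j)))
sumFin₂-*-sumFin e s h = begin
  sumFin (λ i → sumFin (λ j → e i j * sumFin (λ x → s x * h x i j)))
    ≡⟨ sumFin-cong (λ i → sumFin-cong (λ j → trans (sym (sumFin-*ˡ (e i j) (λ x → s x * h x i j)))
                                                     (sumFin-cong (λ x → *-left-comm (e i j) (s x) (h x i j))))) ⟩
  sumFin (λ i → sumFin (λ j → sumFin (λ x → s x * (e i j * h x i j))))
    ≡⟨ sumFin-swap₃ (λ i j x → s x * (e i j * h x i j)) ⟩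
  sumFin (λ x → sumFin (λ i → sumFin (λ j → s x * (e i j * h x i j))))
    ≡⟨ sumFin-cong (λ x → trans (sumFin-cong (λ i → sumFin-*ˡ (s x) (λ j → e i j * h x i j)))
                                (sumFin-*ˡ (s x) (λ i → sumFin (λ j → e i j * h x i j)))) ⟩
  sumFin (λ x → s x * sumFin (λ i → sumFin (λ j → e i j * h x i j))) ∎
  where open ≡-Reasoning

f≤sumFin : ∀ {n} (f : Fin n → ℕ) i → f i ≤ sumFin f
f≤sumFin f zero    = m≤m+n _ _
f≤sumFin f (suc i) = ≤-trans (f≤sumFin (f ∘ suc) i) (m≤n+m _ _)

sumFin-indicator : ∀ {n} (a : Fin n) (d : Fin n → ℕ) →
  sumFin (λ j → if does (a ≟ j) then d j else 0) ≡ d a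
sumFin-indicator {suc n} zero    d = trans (cong (_+_ (d zero)) (sumFin-zero {n})) (+-identityʳ _)
sumFin-indicator {suc n} (suc a) d = sumFin-indicator a (d ∘ suc)

sumFin-b2n≤1 : ∀ {n} (P : Fin n → Bool) → (∀ x y → P x ≡ true → P y ≡ true → x ≡ y) →
  sumFin (b2n ∘ P) ≤ 1
sumFin-b2n≤1 {zero}  P unique = z≤n
sumFin-b2n≤1 {suc n} P unique with P zero in P0
... | true  = ≤-reflexive (cong suc (trans (sumFin-cong rest-false) (sumFin-zero {n})))
  where
  rest-false : ∀ i → b2n (P (suc i)) ≡ 0
  rest-false i with P (suc i) in Pi
  ... | true  = contradiction (unique zero (suc i) P0 Pi) 0≢1+n
  ... | false = refl
... | false = sumFin-b2n≤1 (P ∘ suc) (λ x y Px Py → suc-injective (unique (suc x) (suc y) Px Py))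

f≤maxFin : ∀ {n} (f : Fin n → ℕ) i → f i ≤ maxFin f
f≤maxFin f zero    = m≤m⊔n _ _
f≤maxFin f (suc i) = ≤-trans (f≤maxFin (f ∘ suc) i) (m≤n⊔m _ _)

maxFin≤sumFin : ∀ {n} (f : Fin n → ℕ) → maxFin f ≤ sumFin f
maxFin≤sumFin {zero}  f = z≤n
maxFin≤sumFin {suc n} f = ⊔-lub (m≤m+n _ _) (≤-trans (maxFin≤sumFin (f ∘ suc)) (m≤n+m _ _))

dec-true⁻¹ : ∀ {P : Set} (P? : Dec P) → does P? ≡ true → P
dec-true⁻¹ (yes p) _ = p

1≤b2n : ∀ {b} → b ≡ true → 1 ≤ b2n b
1≤b2n refl = ≤-refl

∧-true : ∀ {x y} → x ≡ true → y ≡ true → (x ∧ y) ≡ true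
∧-true refl refl = refl

∧-true⁻¹ˡ : ∀ {x y} → (x ∧ y) ≡ true → x ≡ true
∧-true⁻¹ˡ {true} _ = refl

∧-true⁻¹ʳ : ∀ {x y} → (x ∧ y) ≡ true → y ≡ true
∧-true⁻¹ʳ {true} e = e

true-or-false : ∀ b → b ≡ true ⊎ b ≡ false
true-or-false true  = inj₁ refl
true-or-false false = inj₂ refl

b2n≤ : ∀ b {k} → (b ≡ true → 1 ≤ k) → b2n b ≤ k
b2n≤ true  1≤k = 1≤k refl
b2n≤ false _   = z≤n

ordered : ∀ {n} → Fin n → Fin n → Bool
ordered i j = toℕ i <ᵇ toℕ j

<⇒<ᵇ≡true : ∀ {m n} → m < n → (m <ᵇ n) ≡ true
<⇒<ᵇ≡true {zero}  {suc n} _       = refl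
<⇒<ᵇ≡true {suc m} {suc n} (s≤s p) = <⇒<ᵇ≡true p

≤⇒>ᵇ≡false : ∀ {m n} → n ≤ m → (m <ᵇ n) ≡ false
≤⇒>ᵇ≡false {m}     {zero}  _       = refl
≤⇒>ᵇ≡false {suc m} {suc n} (s≤s p) = ≤⇒>ᵇ≡false p

b2n-split-ordered : ∀ {n} (a : Fin n → Fin n → Bool) → (∀ i → a i i ≡ false) → ∀ i j x →
  b2n (a i j) * x ≡ b2n (a i j ∧ ordered i j) * x + b2n (a i j ∧ ordered j i) * x
b2n-split-ordered a a-irrefl i j x with <-cmp (toℕ i) (toℕ j)
... | tri< i<j _ _ rewrite <⇒<ᵇ≡true i<j | ≤⇒>ᵇ≡false (<⇒≤ i<j) with a i j
...   | true  = sym (+-identityʳ _)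
...   | false = refl
b2n-split-ordered a a-irrefl i j x | tri> _ _ j<i rewrite <⇒<ᵇ≡true j<i | ≤⇒>ᵇ≡false (<⇒≤ j<i) with a i j
...   | true  = refl
...   | false = refl
b2n-split-ordered a a-irrefl i j x | tri≈ _ i≡j _ rewrite toℕ-injective i≡j | a-irrefl j = refl

handshake : ∀ {n} (a : Fin n → Fin n → Bool) → (∀ i j → a i j ≡ a j i) → (∀ i → a i i ≡ false) →
  (f : Fin n → ℕ) →
  sumFin (λ i → sumFin (λ j → b2n (a i j ∧ ordered i j) * (f i + f j)))
    ≡ sumFin (λ i → f i * degree a i)
handshake {n} a a-sym a-irrefl f = begin
  sumFin (λ i → sumFin (λ j → e i j * (f i + f j)))
    ≡⟨ sumFin-cong (λ i → sumFin-cong (λ j → *-distribˡ-+ (e i j) (f i) (f j))) ⟩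
  sumFin (λ i → sumFin (λ j → e i j * f i + e i j * f j))
    ≡⟨ sumFin₂-+ (λ i j → e i j * f i) (λ i j → e i j * f j) ⟩
  sumFin (λ i → sumFin (λ j → e i j * f i)) + sumFin (λ i → sumFin (λ j → e i j * f j))
    ≡⟨ cong (_+_ _) (sumFin-swap (λ i j → e i j * f j)) ⟩
  sumFin (λ i → sumFin (λ j → e i j * f i)) + sumFin (λ i → sumFin (λ j → e j i * f i))
    ≡⟨ sym (sumFin₂-+ (λ i j → e i j * f i) (λ i j → e j i * f i)) ⟩
  sumFin (λ i → sumFin (λ j → e i j * f i + e j i * f i))
    ≡⟨ sumFin-cong (λ i → sumFin-cong (λ j → sym (split i j))) ⟩
  sumFin (λ i → sumFin (λ j → b2n (a i j) * f i))
    ≡⟨ sumFin-cong (λ i → trans (sumFin-*ʳ (f i) (b2n ∘ a i)) (*-comm _ (f i))) ⟩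
  sumFin (λ i → f i * degree a i) ∎
  where
  open ≡-Reasoning
  e : Fin n → Fin n → ℕ
  e i j = b2n (a i j ∧ ordered i j)
  split : ∀ i j → b2n (a i j) * f i ≡ e i j * f i + e j i * f i
  split i j rewrite a-sym j i = b2n-split-ordered a a-irrefl i j (f i)

degree-sum : ∀ {n} (G : Graph n) → sumFin (degree (adj G)) ≡ 2 * numEdges (adj G)
degree-sum {n} G = begin
  sumFin (degree a)                               ≡⟨ sumFin-cong {n} (λ i → sym (*-identityˡ _)) ⟩
  sumFin (λ i → 1 * degree a i)                   ≡⟨ sym (handshake a (Graph.sym G) (irrefl G) (λ _ → 1)) ⟩
  sumFin (λ i → sumFin (λ j → e i j * 2))         ≡⟨ sumFin-cong (λ i → sumFin-*ʳ 2 (e i)) ⟩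
  sumFin (λ i → sumFin (e i) * 2)                 ≡⟨ sumFin-*ʳ 2 (sumFin ∘ e) ⟩
  numEdges a * 2                                  ≡⟨ *-comm (numEdges a) 2 ⟩
  2 * numEdges a                                  ∎
  where
  open ≡-Reasoning
  a : Fin n → Fin n → Bool
  a = adj G
  e : Fin n → Fin n → ℕ
  e i j = b2n (a i j ∧ ordered i j)

degree≤maxDegree : ∀ {n} (a : Fin n → Fin n → Bool) i → degree a i ≤ maxDegree a
degree≤maxDegree a = f≤maxFin (degree a)

degree-deleteEdges : ∀ {n} (a E : Fin n → Fin n → Bool) i → degree (deleteEdges a E) i ≤ degree a i
degree-deleteEdges a E i = sumFin-mono (λ j → b2n-∧ (a i j) (not (E i j)))
  where
  b2n-∧ : ∀ x y → b2n (x ∧ y) ≤ b2n x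
  b2n-∧ true  true  = ≤-refl
  b2n-∧ true  false = z≤n
  b2n-∧ false _     = z≤n

least-true : ∀ {k} (P : Fin k → Bool) → ∃ (λ x → P x ≡ true) →
  Σ (Fin k) λ y → P y ≡ true × (∀ x → P x ≡ true → toℕ y ≤ toℕ x)
least-true {suc k} P _ with P zero in P0
... | true = zero , P0 , λ _ _ → z≤n
least-true {suc k} P (zero , Px) | false = contradiction (trans (sym P0) Px) λ ()
least-true {suc k} P (suc x , Px) | false with least-true (P ∘ suc) (x , Px)
... | y , Py , least = suc y , Py , least′
  where
  least′ : ∀ x → P x ≡ true → toℕ (suc y) ≤ toℕ x
  least′ zero    Pz = contradiction (trans (sym P0) Pz) λ ()
  least′ (suc x) Px = s≤s (least x Px)

PathIn-head : ∀ {q} {R : Fin q → Fin q → Set} {S : Fin q → Set} {x y} → PathIn R S x y → S x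
PathIn-head (here Sx)     = Sx
PathIn-head (step Sx _ _) = Sx

module RootedTree {p : ℕ} (parent : Fin p → Fin (suc p)) (parent-≤ : ∀ i → toℕ (parent i) ≤ toℕ i) where

  Node : Set
  Node = Fin (suc p)

  parent< : ∀ i → toℕ (parent i) < toℕ (Fin.suc {p} i)
  parent< i = s≤s (parent-≤ i)

  -- Ancestor x z : x lies on the path from z to the root 0.
  data Ancestor : Node → Node → Set where
    self     : ∀ {z} → Ancestor z z
    to-child : ∀ {x} i → Ancestor x (parent i) → Ancestor x (suc i)

  ancestor-≤ : ∀ {x z} → Ancestor x z → toℕ x ≤ toℕ z
  ancestor-≤ self            = ≤-refl
  ancestor-≤ (to-child i xz) = ≤-trans (ancestor-≤ xz) (<⇒≤ (parent< i))

  ancestor-antisym : ∀ {x z} → Ancestor x z → Ancestor z x → x ≡ z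
  ancestor-antisym self            _  = refl
  ancestor-antisym (to-child i xz) zx =
    contradiction (ancestor-≤ zx) (<⇒≱ (≤-<-trans (ancestor-≤ xz) (parent< i)))

  ancestor-trans : ∀ {x y z} → Ancestor x y → Ancestor y z → Ancestor x z
  ancestor-trans xy self            = xy
  ancestor-trans xy (to-child i yz) = to-child i (ancestor-trans xy yz)

  ancestor-total : ∀ {x x′ y} → Ancestor x y → Ancestor x′ y → Ancestor x x′ ⊎ Ancestor x′ x
  ancestor-total self             x′y              = inj₂ x′y
  ancestor-total (to-child i xy)  self             = inj₁ (to-child i xy)
  ancestor-total (to-child i xy)  (to-child .i x′y) = ancestor-total xy x′y

  ancestor-of-child : ∀ {x i} → Ancestor x (suc i) → x ≡ suc i ⊎ Ancestor x (parent i)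
  ancestor-of-child self            = inj₁ refl
  ancestor-of-child (to-child i xz) = inj₂ xz

  PathIn-below-least : ∀ {B : Node → Bool} {r} → (∀ x → B x ≡ true → toℕ r ≤ toℕ x) →
    ∀ {x y} → Ancestor r x → PathIn (TreeEdge parent) (λ z → B z ≡ true) x y → Ancestor r y
  PathIn-below-least least rx (here _) = rx
  PathIn-below-least least rx (step _ (up i) path) with ancestor-of-child rx
  ... | inj₁ refl = contradiction (least _ (PathIn-head path)) (<⇒≱ (parent< i))
  ... | inj₂ r-parent = PathIn-below-least least r-parent path
  PathIn-below-least least rx (step _ (down i) path) = PathIn-below-least least (to-child i rx) path

  PathIn-exits-through : ∀ {B : Node → Bool} {x y w} → Ancestor x y →
    PathIn (TreeEdge parent) (λ z → B z ≡ true) y w → B x ≡ true ⊎ Ancestor x w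
  PathIn-exits-through xy (here _) = inj₂ xy
  PathIn-exits-through xy (step By (up i) path) with ancestor-of-child xy
  ... | inj₁ refl     = inj₁ By
  ... | inj₂ x-parent = PathIn-exits-through x-parent path
  PathIn-exits-through xy (step _ (down i) path) = PathIn-exits-through (to-child i xy) path

  data Climb (S : Node → Bool) : Node → Node → Set where
    arrive : ∀ {z} → Climb S z z
    climb  : ∀ {w} i → S (suc i) ≡ false → Climb S (parent i) w → Climb S (suc i) w

  climb? : ∀ S (fuel : ℕ) z w → toℕ z < fuel → Dec (Climb S z w)
  climb? S fuel z w z<fuel with z ≟ w
  ... | yes refl = yes arrive
  climb? S (suc fuel) zero    w _ | no z≢w = no λ { arrive → z≢w refl }
  climb? S (suc fuel) (suc i) w (s≤s i<fuel) | no z≢w with S (suc i) in Si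
  ... | true = no λ { arrive → z≢w refl ; (climb .i Si′ _) → contradiction (trans (sym Si) Si′) λ () }
  ... | false with climb? S fuel (parent i) w (≤-<-trans (parent-≤ i) i<fuel)
  ...   | yes c = yes (climb i Si c)
  ...   | no ¬c = no λ { arrive → z≢w refl ; (climb .i _ c) → ¬c c }

  climbs : (Node → Bool) → Node → Node → Bool
  climbs S z w = does (climb? S (suc (toℕ z)) z w ≤-refl)

  climbs⇒Climb : ∀ {S z w} → climbs S z w ≡ true → Climb S z w
  climbs⇒Climb {S} {z} {w} = dec-true⁻¹ (climb? S (suc (toℕ z)) z w ≤-refl)

  climb-≤ : ∀ {S z w} → Climb S z w → toℕ w ≤ toℕ z
  climb-≤ arrive        = ≤-refl
  climb-≤ (climb i _ c) = ≤-trans (climb-≤ c) (<⇒≤ (parent< i))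

  climb-resp : ∀ {S S′ z w} → (∀ u → toℕ w < toℕ u → S u ≡ S′ u) → Climb S z w → Climb S′ z w
  climb-resp S≡S′ arrive = arrive
  climb-resp S≡S′ (climb i Si c) =
    climb i (trans (sym (S≡S′ (suc i) (≤-<-trans (climb-≤ c) (parent< i)))) Si) (climb-resp S≡S′ c)

  climb-unique : ∀ {S z x y} → Climb S z x → Climb S z y → S x ≡ true → S y ≡ true → x ≡ y
  climb-unique arrive          arrive          Sx Sy = refl
  climb-unique arrive          (climb i Si _)  Sx Sy = contradiction (trans (sym Sx) Si) λ ()
  climb-unique (climb i Si _)  arrive          Sx Sy = contradiction (trans (sym Sy) Si) λ ()
  climb-unique (climb i _ cx)  (climb .i _ cy) Sx Sy = climb-unique cx cy Sx Sy

  data ClimbOutside (S : Node → Bool) : Node → Node → Set where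
    arrive : ∀ {z} → S z ≡ false → ClimbOutside S z z
    climb  : ∀ {w} i → S (suc i) ≡ false → ClimbOutside S (parent i) w → ClimbOutside S (suc i) w

  climbOutside-first : ∀ {S z w} → ClimbOutside S z w → S z ≡ false
  climbOutside-first (arrive Sz)    = Sz
  climbOutside-first (climb i Si _) = Si

  climbOutside-last : ∀ {S z w} → ClimbOutside S z w → S w ≡ false
  climbOutside-last (arrive Sw)   = Sw
  climbOutside-last (climb i _ c) = climbOutside-last c

  climbOutside-or-cut : ∀ S {z z′} → Ancestor z′ z →
    ClimbOutside S z z′ ⊎ ∃ λ x → S x ≡ true × Ancestor x z × Ancestor z′ x
  climbOutside-or-cut S {z} self with S z in Sz
  ... | true  = inj₂ (z , Sz , self , self)
  ... | false = inj₁ (arrive Sz)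
  climbOutside-or-cut S (to-child i z′z) with S (suc i) in Si
  ... | true = inj₂ (suc i , Si , self , to-child i z′z)
  ... | false with climbOutside-or-cut S z′z
  ...   | inj₁ c                 = inj₁ (climb i Si c)
  ...   | inj₂ (x , Sx , xz , z′x) = inj₂ (x , Sx , to-child i xz , z′x)

  -- The highest node reachable from z by climbing outside S (the fuel only ensures termination).
  headWithFuel : (Node → Bool) → ℕ → Node → Node
  headWithFuel S zero       z       = z
  headWithFuel S (suc fuel) zero    = zero
  headWithFuel S (suc fuel) (suc i) = if S (parent i) then suc i else headWithFuel S fuel (parent i)

  headWithFuel-irrelevant : ∀ S f f′ z → toℕ z < f → toℕ z < f′ →
    headWithFuel S f z ≡ headWithFuel S f′ z
  headWithFuel-irrelevant S (suc f) (suc f′) zero    _       _        = refl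
  headWithFuel-irrelevant S (suc f) (suc f′) (suc i) (s≤s i<f) (s≤s i<f′) with S (parent i)
  ... | true  = refl
  ... | false = headWithFuel-irrelevant S f f′ (parent i)
                  (≤-<-trans (parent-≤ i) i<f) (≤-<-trans (parent-≤ i) i<f′)

  branchHead : (Node → Bool) → Node → Node
  branchHead S z = headWithFuel S (suc (toℕ z)) z

  climbOutside-branchHead : ∀ {S z w} → ClimbOutside S z w → branchHead S z ≡ branchHead S w
  climbOutside-branchHead (arrive _) = refl
  climbOutside-branchHead {S} (climb i _ c) rewrite climbOutside-first c =
    trans (headWithFuel-irrelevant S (suc (toℕ i)) (suc (toℕ (parent i))) (parent i) (s≤s (parent-≤ i)) ≤-refl)
          (climbOutside-branchHead c)

  headWithFuel-climb : ∀ S f z → toℕ z < f → S z ≡ false →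
    Climb S z (headWithFuel S f z) × S (headWithFuel S f z) ≡ false
  headWithFuel-climb S (suc f) zero    _         Sz = arrive , Sz
  headWithFuel-climb S (suc f) (suc i) (s≤s i<f) Si with S (parent i) in Sp
  ... | true  = arrive , Si
  ... | false with headWithFuel-climb S f (parent i) (≤-<-trans (parent-≤ i) i<f) Sp
  ...   | c , Sh = climb i Si c , Sh

  branchHead-climb : ∀ S z → S z ≡ false → Climb S z (branchHead S z) × S (branchHead S z) ≡ false
  branchHead-climb S z = headWithFuel-climb S (suc (toℕ z)) z ≤-refl

module GreedyCut {p : ℕ} (parent : Fin p → Fin (suc p)) (parent-≤ : ∀ i → toℕ (parent i) ≤ toℕ i)
                 {n : ℕ} (top : Fin n → Fin (suc p)) (weight : Fin n → ℕ) (threshold : ℕ) where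

  open RootedTree parent parent-≤

  pending : (Node → Bool) → Node → ℕ
  pending S x = sumFin (λ v → if climbs S (top v) x then weight v else 0)

  pending-resp : ∀ S S′ x → (∀ u → toℕ x < toℕ u → S u ≡ S′ u) → pending S x ≡ pending S′ x
  pending-resp S S′ x S≡S′ = sumFin-cong λ v → cong (λ b → if b then weight v else 0)
    (does-⇔ (mk⇔ (climb-resp S≡S′) (climb-resp (λ u x<u → sym (S≡S′ u x<u))))
            (climb? S _ (top v) x ≤-refl) (climb? S′ _ (top v) x ≤-refl))

  Balanced : (Node → Bool) → Node → Set
  Balanced S x = (S x ≡ true → threshold ≤ pending S x) × (S x ≡ false → pending S x < threshold)

  -- Nodes are decided from the largest index down; a decision only looks at larger indices.
  balanced-from : ∀ d → Σ (Node → Bool) λ S → ∀ x → suc p ≤ toℕ x + d → Balanced S x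
  balanced-from zero =
    (λ _ → false) , λ x p<x → contradiction (≤-trans p<x (≤-reflexive (+-identityʳ _))) (<⇒≱ (toℕ<n x))
  balanced-from (suc d) with balanced-from d
  ... | S , balanced = S′ , balanced′
    where
    S′ : Node → Bool
    S′ y = if does (toℕ y + d ≟ℕ p) then does (threshold ≤? pending S y) else S y

    S′-agrees-above : ∀ y → p ≤ toℕ y + d → ∀ u → toℕ y < toℕ u → S′ u ≡ S u
    S′-agrees-above y p≤y u y<u
      rewrite dec-false (toℕ u + d ≟ℕ p) (λ u≡p → <⇒≢ (≤-<-trans p≤y (+-monoˡ-< d y<u)) (sym u≡p))
      = refl

    p≤x+d : ∀ x → suc p ≤ toℕ x + suc d → p ≤ toℕ x + d
    p≤x+d x p<x = ≤-pred (≤-trans p<x (≤-reflexive (+-suc (toℕ x) d)))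

    balanced′ : ∀ x → suc p ≤ toℕ x + suc d → Balanced S′ x
    balanced′ x p<x with toℕ x + d ≟ℕ p | pending-resp S′ S x (S′-agrees-above x (p≤x+d x p<x))
    ... | yes x≡p | same rewrite dec-true (toℕ x + d ≟ℕ p) x≡p with threshold ≤? pending S x
    ...   | yes t≤ rewrite dec-true (threshold ≤? pending S x) t≤ =
      (λ _ → subst (threshold ≤_) (sym same) t≤) , λ ()
    ...   | no  t≰ rewrite dec-false (threshold ≤? pending S x) t≰ =
      (λ ()) , λ _ → subst (_< threshold) (sym same) (≰⇒> t≰)
    balanced′ x p<x | no x≢p | same rewrite dec-false (toℕ x + d ≟ℕ p) x≢p =
      (λ Sx → subst (threshold ≤_) (sym same) (proj₁ (balanced x p<x′) Sx)) ,
      (λ Sx → subst (_< threshold) (sym same) (proj₂ (balanced x p<x′) Sx))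
      where
      p<x′ : suc p ≤ toℕ x + d
      p<x′ = ≤∧≢⇒< (p≤x+d x p<x) (x≢p ∘ sym)

  balanced-cut : Σ (Node → Bool) λ S → ∀ x → Balanced S x
  balanced-cut with balanced-from (suc p)
  ... | S , balanced = S , λ x → balanced x (m≤n+m _ _)

↑ˡ≢↑ʳ : ∀ {m n} (i : Fin m) (j : Fin n) → i ↑ˡ n ≢ m ↑ʳ j
↑ˡ≢↑ʳ {m} {n} i j eq with trans (sym (splitAt-↑ˡ m i n)) (trans (cong (splitAt m) eq) (splitAt-↑ʳ m n j))
... | ()

module CutPartition {n : ℕ} (G : Graph n) (E' : Fin n → Fin n → Bool) (E'-sym : ∀ i j → E' i j ≡ E' j i)
  (t : ℕ) (TD : TreewidthAtMost (deleteEdges (adj G) E') t) (L : ℕ) (Δ≤L : maxDegree (adj G) ≤ L) where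

  open TreeDecomposition TD
  open RootedTree parent parent-lt

  a : Fin n → Fin n → Bool
  a = adj G

  a′ : Fin n → Fin n → Bool
  a′ = deleteEdges a E'

  topBag : ∀ v → Σ Node λ y → bag y v ≡ true × (∀ x → bag x v ≡ true → toℕ y ≤ toℕ x)
  topBag v = least-true (λ x → bag x v) (cover-v v)

  top : Fin n → Node
  top = proj₁ ∘ topBag

  top-in : ∀ v → bag (top v) v ≡ true
  top-in v = proj₁ (proj₂ (topBag v))

  top-ancestor : ∀ v y → bag y v ≡ true → Ancestor (top v) y
  top-ancestor v y b = PathIn-below-least (proj₂ (proj₂ (topBag v))) self (subtree v (top v) y (top-in v) b)

  open GreedyCut parent parent-lt top (degree a) (suc L)

  S : Node → Bool
  S = proj₁ balanced-cut

  balanced : ∀ x → Balanced S x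
  balanced = proj₂ balanced-cut

  labelling : Fin n → Fin (suc p + n)
  labelling v = if S (top v) then suc p ↑ʳ v else branchHead S (top v) ↑ˡ n

  cutSize : ℕ
  cutSize = sumFin (b2n ∘ S)

  climbs-into-cut-unique : ∀ v → sumFin (λ x → b2n (S x ∧ climbs S (top v) x)) ≤ 1
  climbs-into-cut-unique v = sumFin-b2n≤1 (λ x → S x ∧ climbs S (top v) x) unique
    where
    unique : ∀ x y → (S x ∧ climbs S (top v) x) ≡ true → (S y ∧ climbs S (top v) y) ≡ true → x ≡ y
    unique x y hx hy with S x in Sx | S y in Sy
    ... | true | true = climb-unique (climbs⇒Climb {S} {top v} hx) (climbs⇒Climb {S} {top v} hy) Sx Sy

  cut-pending : cutSize * suc L ≤ sumFin (λ x → b2n (S x) * pending S x)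
  cut-pending = ≤-trans (≤-reflexive (sym (sumFin-*ʳ (suc L) (b2n ∘ S)))) (sumFin-mono per-node)
    where
    per-node : ∀ x → b2n (S x) * suc L ≤ b2n (S x) * pending S x
    per-node x with S x in Sx
    ... | true  = +-monoˡ-≤ 0 (proj₁ (balanced x) Sx)
    ... | false = z≤n

  cut-pending-total : sumFin (λ x → b2n (S x) * pending S x) ≤ sumFin (degree a)
  cut-pending-total = begin
    sumFin (λ x → b2n (S x) * pending S x)
      ≡⟨ sumFin-cong (λ x → trans (sym (sumFin-*ˡ (b2n (S x))
                                             (λ v → if climbs S (top v) x then degree a v else 0)))
                                  (sumFin-cong (owned x))) ⟩
    sumFin (λ x → sumFin (λ v → b2n (S x ∧ climbs S (top v) x) * degree a v))
      ≡⟨ sumFin-swap (λ x v → b2n (S x ∧ climbs S (top v) x) * degree a v) ⟩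
    sumFin (λ v → sumFin (λ x → b2n (S x ∧ climbs S (top v) x) * degree a v))
      ≡⟨ sumFin-cong (λ v → sumFin-*ʳ (degree a v) (λ x → b2n (S x ∧ climbs S (top v) x))) ⟩
    sumFin (λ v → sumFin (λ x → b2n (S x ∧ climbs S (top v) x)) * degree a v)
      ≤⟨ sumFin-mono (λ v → ≤-trans (*-monoˡ-≤ (degree a v) (climbs-into-cut-unique v))
                                     (≤-reflexive (*-identityˡ _))) ⟩
    sumFin (degree a) ∎
    where
    open ≤-Reasoning
    owned : ∀ x v → b2n (S x) * (if climbs S (top v) x then degree a v else 0)
                  ≡ b2n (S x ∧ climbs S (top v) x) * degree a v
    owned x v with S x | climbs S (top v) x
    ... | true  | true  = refl
    ... | true  | false = *-zeroʳ 1
    ... | false | _     = refl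

  cutSize-bound : cutSize * suc L ≤ 2 * numEdges a
  cutSize-bound = ≤-trans cut-pending (≤-trans cut-pending-total (≤-reflexive (degree-sum G)))

  labelling-head : ∀ v w → labelling v ≡ w ↑ˡ n → Climb S (top v) w × S w ≡ false
  labelling-head v w eq with S (top v) in St
  ... | true  = contradiction (sym eq) (↑ˡ≢↑ʳ w v)
  ... | false rewrite sym (↑ˡ-injective n _ w eq) = branchHead-climb S (top v) St

  labelling-singleton : ∀ v u → labelling v ≡ suc p ↑ʳ u → v ≡ u
  labelling-singleton v u eq with S (top v)
  ... | true  = ↑ʳ-injective (suc p) v u eq
  ... | false = contradiction eq (↑ˡ≢↑ʳ _ u)

  vol-headClass : ∀ w → vol a (part labelling (w ↑ˡ n)) ≤ L
  vol-headClass w with S w in Sw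
  ... | true = ≤-trans (≤-reflexive (trans (sumFin-cong empty) (sumFin-zero {n}))) z≤n
    where
    empty : ∀ v → (if does (labelling v ≟ w ↑ˡ n) then degree a v else 0) ≡ 0
    empty v with labelling v ≟ w ↑ˡ n
    ... | no _   = refl
    ... | yes eq = contradiction (trans (sym Sw) (proj₂ (labelling-head v w eq))) λ ()
  ... | false = ≤-trans (sumFin-mono member) (≤-pred (proj₂ (balanced w) Sw))
    where
    member : ∀ v → (if does (labelling v ≟ w ↑ˡ n) then degree a v else 0)
                 ≤ (if climbs S (top v) w then degree a v else 0)
    member v with labelling v ≟ w ↑ˡ n
    ... | no _ = z≤n
    ... | yes eq rewrite dec-true (climb? S _ (top v) w ≤-refl) (proj₁ (labelling-head v w eq)) = ≤-refl

  vol-singletonClass : ∀ u → vol a (part labelling (suc p ↑ʳ u)) ≤ L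
  vol-singletonClass u = begin
    vol a (part labelling (suc p ↑ʳ u))                  ≤⟨ sumFin-mono member ⟩
    sumFin (λ v → if does (u ≟ v) then degree a v else 0) ≡⟨ sumFin-indicator u (degree a) ⟩
    degree a u                                           ≤⟨ degree≤maxDegree a u ⟩
    maxDegree a                                          ≤⟨ Δ≤L ⟩
    L                                                    ∎
    where
    open ≤-Reasoning
    member : ∀ v → (if does (labelling v ≟ suc p ↑ʳ u) then degree a v else 0)
                 ≤ (if does (u ≟ v) then degree a v else 0)
    member v with labelling v ≟ suc p ↑ʳ u
    ... | no _ = z≤n
    ... | yes eq rewrite labelling-singleton v u eq | dec-true (u ≟ u) refl = ≤-refl

  vol-part≤L : ∀ c → vol a (part labelling c) ≤ L
  vol-part≤L c with splitAt (suc p) c in eq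
  ... | inj₁ w = subst (λ c → vol a (part labelling c) ≤ L) (splitAt⁻¹-↑ˡ eq) (vol-headClass w)
  ... | inj₂ u = subst (λ c → vol a (part labelling c) ≤ L) (splitAt⁻¹-↑ʳ eq) (vol-singletonClass u)

  vol-total : sumFin (λ c → vol a (part labelling c)) ≡ sumFin (degree a)
  vol-total = trans (sumFin-swap (λ c v → if does (labelling v ≟ c) then degree a v else 0))
                    (sumFin-cong (λ v → sumFin-indicator (labelling v) (λ _ → degree a v)))

  vol²-bound : sumFin (λ c → vol a (part labelling c) * vol a (part labelling c)) ≤ L * (2 * numEdges a)
  vol²-bound = begin
    sumFin (λ c → vol a (part labelling c) * vol a (part labelling c))
      ≤⟨ sumFin-mono (λ c → *-monoˡ-≤ (vol a (part labelling c)) (vol-part≤L c)) ⟩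
    sumFin (λ c → L * vol a (part labelling c))
      ≡⟨ sumFin-*ˡ L (λ c → vol a (part labelling c)) ⟩
    L * sumFin (λ c → vol a (part labelling c))
      ≡⟨ cong (L *_) (trans vol-total (degree-sum G)) ⟩
    L * (2 * numEdges a) ∎
    where open ≤-Reasoning

  labelling-climbOutside : ∀ u v → ClimbOutside S (top u) (top v) → labelling u ≡ labelling v
  labelling-climbOutside u v c rewrite climbOutside-first c | climbOutside-last c =
    cong (_↑ˡ n) (climbOutside-branchHead c)

  -- If u's top bag lies below v's, a cut node between the two tops is, by the subtree property of
  -- v's bags, either a bag of v or v's top bag itself.
  cut-separates : ∀ u v y → bag y u ≡ true → bag y v ≡ true → Ancestor (top v) (top u) →
    labelling u ≢ labelling v → ∃ λ x → S x ≡ true × (bag x u ≡ true ⊎ bag x v ≡ true)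
  cut-separates u v y bu bv tv-tu different with climbOutside-or-cut S tv-tu
  ... | inj₁ c = contradiction (labelling-climbOutside u v c) different
  ... | inj₂ (x , Sx , x-tu , tv-x)
    with PathIn-exits-through (ancestor-trans x-tu (top-ancestor u y bu)) (subtree v y (top v) bv (top-in v))
  ...   | inj₁ bxv  = x , Sx , inj₂ bxv
  ...   | inj₂ x-tv = x , Sx , inj₂ (subst (λ z → bag z v ≡ true) (ancestor-antisym tv-x x-tv) (top-in v))

  crossing-edge-meets-cut : ∀ i j → a′ i j ≡ true → labelling i ≢ labelling j →
    ∃ λ x → S x ≡ true × (bag x i ≡ true ⊎ bag x j ≡ true)
  crossing-edge-meets-cut i j edge different with cover-e i j edge
  ... | y , bi , bj with ancestor-total (top-ancestor i y bi) (top-ancestor j y bj)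
  ...   | inj₂ tj-ti = cut-separates i j y bi bj tj-ti different
  ...   | inj₁ ti-tj = map₂ (map₂ swap) (cut-separates j i y bj bi ti-tj (different ∘ sym))

  internal : Fin n → Fin n → ℕ
  internal i j = sumFin (λ c → b2n (does (labelling i ≟ c) ∧ does (labelling j ≟ c) ∧ a i j ∧ ordered i j))

  deleted : Fin n → Fin n → ℕ
  deleted i j = b2n (E' i j ∧ ordered i j)

  charged : Fin n → Fin n → ℕ
  charged i j = b2n (a′ i j ∧ ordered i j) * sumFin (λ x → b2n (S x) * (b2n (bag x i) + b2n (bag x j)))

  1≤internal : ∀ i j → a i j ≡ true → ordered i j ≡ true → labelling i ≡ labelling j → 1 ≤ internal i j
  1≤internal i j edge i<j same = ≤-trans
    (1≤b2n (∧-true (dec-true (labelling i ≟ labelling i) refl)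
           (∧-true (dec-true (labelling j ≟ labelling i) (sym same)) (∧-true edge i<j))))
    (f≤sumFin (λ c → b2n (does (labelling i ≟ c) ∧ does (labelling j ≟ c) ∧ a i j ∧ ordered i j))
              (labelling i))

  1≤charged : ∀ i j → a′ i j ≡ true → ordered i j ≡ true → labelling i ≢ labelling j → 1 ≤ charged i j
  1≤charged i j edge i<j different with crossing-edge-meets-cut i j edge different
  ... | x , Sx , meets = *-mono-≤ (1≤b2n (∧-true edge i<j)) (≤-trans (1≤term meets)
          (f≤sumFin (λ x → b2n (S x) * (b2n (bag x i) + b2n (bag x j))) x))
    where
    1≤term : bag x i ≡ true ⊎ bag x j ≡ true → 1 ≤ b2n (S x) * (b2n (bag x i) + b2n (bag x j))
    1≤term (inj₁ bi) = *-mono-≤ (1≤b2n Sx) (≤-trans (1≤b2n bi) (m≤m+n _ _))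
    1≤term (inj₂ bj) = *-mono-≤ (1≤b2n Sx) (≤-trans (1≤b2n bj) (m≤n+m _ _))

  edge-accounted : ∀ i j → b2n (a i j ∧ ordered i j) ≤ internal i j + deleted i j + charged i j
  edge-accounted i j = b2n≤ (a i j ∧ ordered i j) (λ e → accounted (∧-true⁻¹ˡ e) (∧-true⁻¹ʳ e))
    where
    accounted : a i j ≡ true → ordered i j ≡ true → 1 ≤ internal i j + deleted i j + charged i j
    accounted edge i<j with labelling i ≟ labelling j | true-or-false (E' i j)
    ... | yes same      | _        =
      ≤-trans (1≤internal i j edge i<j same) (≤-trans (m≤m+n _ (deleted i j)) (m≤m+n _ (charged i j)))
    ... | no  _         | inj₁ del =
      ≤-trans (1≤b2n (∧-true del i<j)) (≤-trans (m≤n+m _ (internal i j)) (m≤m+n _ (charged i j)))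
    ... | no  different | inj₂ kept =
      ≤-trans (1≤charged i j (∧-true edge (cong not kept)) i<j different) (m≤n+m _ (internal i j + deleted i j))

  internalEdges : ℕ
  internalEdges = sumFin (λ c → edgesIn a (part labelling c))

  bag-degree≤ : ∀ x → sumFin (λ i → b2n (bag x i) * degree a′ i) ≤ suc t * maxDegree a
  bag-degree≤ x = begin
    sumFin (λ i → b2n (bag x i) * degree a′ i)
      ≤⟨ sumFin-mono (λ i → *-monoʳ-≤ (b2n (bag x i))
                                (≤-trans (degree-deleteEdges a E' i) (degree≤maxDegree a i))) ⟩
    sumFin (λ i → b2n (bag x i) * maxDegree a) ≡⟨ sumFin-*ʳ (maxDegree a) (b2n ∘ bag x) ⟩
    card (bag x) * maxDegree a                 ≤⟨ *-monoˡ-≤ (maxDegree a) (bag-size x) ⟩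
    suc t * maxDegree a                        ∎
    where open ≤-Reasoning

  charged-total : sumFin (λ i → sumFin (charged i)) ≤ cutSize * (suc t * maxDegree a)
  charged-total = begin
    sumFin (λ i → sumFin (charged i))
      ≡⟨ sumFin₂-*-sumFin (λ i j → b2n (a′ i j ∧ ordered i j)) (b2n ∘ S)
                          (λ x i j → b2n (bag x i) + b2n (bag x j)) ⟩
    sumFin (λ x → b2n (S x) * sumFin (λ i → sumFin (λ j →
      b2n (a′ i j ∧ ordered i j) * (b2n (bag x i) + b2n (bag x j)))))
      ≡⟨ sumFin-cong (λ x → cong (b2n (S x) *_) (handshake a′ a′-sym a′-irrefl (b2n ∘ bag x))) ⟩
    sumFin (λ x → b2n (S x) * sumFin (λ i → b2n (bag x i) * degree a′ i))
      ≤⟨ sumFin-mono (λ x → *-monoʳ-≤ (b2n (S x)) (bag-degree≤ x)) ⟩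
    sumFin (λ x → b2n (S x) * (suc t * maxDegree a))
      ≡⟨ sumFin-*ʳ (suc t * maxDegree a) (b2n ∘ S) ⟩
    cutSize * (suc t * maxDegree a) ∎
    where
    open ≤-Reasoning
    a′-sym : ∀ i j → a′ i j ≡ a′ j i
    a′-sym i j = cong₂ _∧_ (Graph.sym G i j) (cong not (E'-sym i j))
    a′-irrefl : ∀ i → a′ i i ≡ false
    a′-irrefl i rewrite irrefl G i = refl

  edges-accounted : numEdges a ≤ internalEdges + numEdges E' + cutSize * (suc t * maxDegree a)
  edges-accounted = begin
    numEdges a
      ≤⟨ sumFin-mono (λ i → sumFin-mono (edge-accounted i)) ⟩
    sumFin (λ i → sumFin (λ j → internal i j + deleted i j + charged i j))
      ≡⟨ sumFin₂-+ (λ i j → internal i j + deleted i j) charged ⟩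
    sumFin (λ i → sumFin (λ j → internal i j + deleted i j)) + sumFin (λ i → sumFin (charged i))
      ≡⟨ cong (λ k → k + sumFin (λ i → sumFin (charged i))) (sumFin₂-+ internal deleted) ⟩
    sumFin (λ i → sumFin (internal i)) + numEdges E' + sumFin (λ i → sumFin (charged i))
      ≤⟨ +-mono-≤ (≤-reflexive (cong (λ k → k + numEdges E') internal-total)) charged-total ⟩
    internalEdges + numEdges E' + cutSize * (suc t * maxDegree a) ∎
    where
    open ≤-Reasoning
    internal-total : sumFin (λ i → sumFin (internal i)) ≡ internalEdges
    internal-total = sumFin-swap₃
      (λ i j c → b2n (does (labelling i ≟ c) ∧ does (labelling j ≟ c) ∧ a i j ∧ ordered i j))

integer-sqrt : ∀ N → ∃ λ L → L * L ≤ N × N < suc L * suc L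
integer-sqrt zero = 0 , z≤n , s≤s z≤n
integer-sqrt (suc N) with integer-sqrt N
... | L , L²≤N , N<[1+L]² with suc N <? suc L * suc L
...   | yes 1+N<[1+L]² = L , ≤-trans L²≤N (n≤1+n N) , 1+N<[1+L]²
...   | no  1+N≮[1+L]² =
  suc L , ≮⇒≥ 1+N≮[1+L]² , ≤-trans (s≤s N<[1+L]²) (*-mono-< (n<1+n (suc L)) (n<1+n (suc L)))

≤-integer-sqrt : ∀ {a N L} → a * a ≤ N → N < suc L * suc L → a ≤ L
≤-integer-sqrt {a} {N} {L} a²≤N N<[1+L]² with a ≤? L
... | yes a≤L = a≤L
... | no  a≰L =
  contradiction (≤-<-trans (≤-trans (*-mono-≤ (≰⇒> a≰L) (≰⇒> a≰L)) a²≤N) N<[1+L]²) (<-irrefl refl)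

-- With L = ⌊√N⌋ and a ≤ N/(L+1) this says a + L ≤ 2√N.
[a+L]²≤4N : ∀ a L N → a * suc L ≤ N → L * L ≤ N → N < suc L * suc L → (a + L) * (a + L) ≤ 4 * N
[a+L]²≤4N a L N a[1+L]≤N L²≤N N<[1+L]² = *-cancelʳ-≤ ((a + L) * (a + L)) (4 * N) (suc L * suc L) (begin
  (a + L) * (a + L) * (suc L * suc L)  ≡⟨ solve 2 (λ a L → (a :+ L) :* (a :+ L) :* ((con 1 :+ L) :* (con 1 :+ L))
                                               := ((a :+ L) :* (con 1 :+ L)) :* ((a :+ L) :* (con 1 :+ L))) refl a L ⟩
  ((a + L) * suc L) * ((a + L) * suc L) ≤⟨ *-mono-≤ [a+L][1+L]≤X [a+L][1+L]≤X ⟩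
  X * X                                  ≡⟨ cong (λ k → (k + L * suc L) * (k + L * suc L)) N≡L²+e ⟩
  X′ * X′                                ≤⟨ X′²≤ ⟩
  4 * (L * L + e) * (suc L * suc L)      ≡⟨ cong (λ k → 4 * k * (suc L * suc L)) (sym N≡L²+e) ⟩
  4 * N * (suc L * suc L)                ∎)
  where
  open ≤-Reasoning
  open ℕSolver.+-*-Solver
  e : ℕ
  e = N ∸ L * L
  N≡L²+e : N ≡ L * L + e
  N≡L²+e = sym (m+[n∸m]≡n L²≤N)
  e≤2L : e ≤ 2 * L
  e≤2L = m≤n+o⇒m∸n≤o N (L * L) (≤-pred (≤-trans N<[1+L]² (≤-reflexive
    (solve 1 (λ L → (con 1 :+ L) :* (con 1 :+ L) := con 1 :+ (L :* L :+ con 2 :* L)) refl L))))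
  X X′ : ℕ
  X  = N + L * suc L
  X′ = L * L + e + L * suc L
  [a+L][1+L]≤X : (a + L) * suc L ≤ X
  [a+L][1+L]≤X = ≤-trans (≤-reflexive (*-distribʳ-+ (suc L) a L)) (+-monoˡ-≤ (L * suc L) a[1+L]≤N)
  -- X′² + R = 4 (L² + e)(L + 1)² + e², and e² ≤ R because e ≤ 2L.
  R : ℕ
  R = 4 * (L * L * L) + 3 * (L * L) + 6 * (e * L) + 4 * e
  e²≤R : e * e ≤ R
  e²≤R = begin
    e * e       ≤⟨ *-monoʳ-≤ e e≤2L ⟩
    e * (2 * L) ≡⟨ solve 2 (λ e L → e :* (con 2 :* L) := con 2 :* (e :* L)) refl e L ⟩
    2 * (e * L) ≤⟨ *-monoˡ-≤ (e * L) {2} {6} (s≤s (s≤s z≤n)) ⟩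
    6 * (e * L) ≤⟨ m≤n+m _ (4 * (L * L * L) + 3 * (L * L)) ⟩
    4 * (L * L * L) + 3 * (L * L) + 6 * (e * L) ≤⟨ m≤m+n _ (4 * e) ⟩
    R ∎
  X′²≤ : X′ * X′ ≤ 4 * (L * L + e) * (suc L * suc L)
  X′²≤ = +-cancelʳ-≤ (e * e) _ _ (begin
    X′ * X′ + e * e ≤⟨ +-monoʳ-≤ (X′ * X′) e²≤R ⟩
    X′ * X′ + R     ≡⟨ solve 2 (λ L e →
                          (L :* L :+ e :+ L :* (con 1 :+ L)) :* (L :* L :+ e :+ L :* (con 1 :+ L))
                            :+ (con 4 :* (L :* L :* L) :+ con 3 :* (L :* L) :+ con 6 :* (e :* L) :+ con 4 :* e)
                          := con 4 :* (L :* L :+ e) :* ((con 1 :+ L) :* (con 1 :+ L)) :+ e :* e) refl L e ⟩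
    4 * (L * L + e) * (suc L * suc L) + e * e ∎)

deficit-numerator-bound : ∀ m E P Q C L K →
  m ≤ P + E + K * C → Q ≤ L * (2 * m) → K * suc L ≤ 2 * m →
  L * L ≤ 4 * C * m → 4 * C * m < suc L * suc L →
  ∀ z → z + 4 * m * (P + E) ≤ 4 * m * m + Q → z * z ≤ 64 * C * m * m * m
deficit-numerator-bound m E P Q C L K m≤ Q≤ K[1+L]≤ L²≤ 4Cm< z z+≤ = begin
  z * z                               ≤⟨ *-mono-≤ z≤ z≤ ⟩
  (2 * m * B) * (2 * m * B)           ≡⟨ solve 2 (λ m B → (con 2 :* m :* B) :* (con 2 :* m :* B)
                                                       := con 4 :* m :* m :* (B :* B)) refl m B ⟩
  4 * m * m * (B * B)                 ≤⟨ *-monoʳ-≤ (4 * m * m) B²≤ ⟩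
  4 * m * m * (4 * (4 * C * m))       ≡⟨ solve 2 (λ m C → con 4 :* m :* m :* (con 4 :* (con 4 :* C :* m))
                                                       := con 64 :* C :* m :* m :* m) refl m C ⟩
  64 * C * m * m * m                  ∎
  where
  open ≤-Reasoning
  open ℕSolver.+-*-Solver
  B : ℕ
  B = 2 * K * C + L
  z≤ : z ≤ 2 * m * B
  z≤ = +-cancelʳ-≤ (4 * m * (P + E)) z (2 * m * B) (≤-trans z+≤ (begin
    4 * m * m + Q                          ≤⟨ +-mono-≤ (*-monoʳ-≤ (4 * m) m≤) Q≤ ⟩
    4 * m * (P + E + K * C) + L * (2 * m)  ≡⟨ solve 6 (λ m E P C L K →
                                                con 4 :* m :* (P :+ E :+ K :* C) :+ L :* (con 2 :* m)
                                                := con 2 :* m :* (con 2 :* K :* C :+ L) :+ con 4 :* m :* (P :+ E))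
                                                refl m E P C L K ⟩
    2 * m * B + 4 * m * (P + E)            ∎))
  B²≤ : B * B ≤ 4 * (4 * C * m)
  B²≤ = [a+L]²≤4N (2 * K * C) L (4 * C * m) (begin
    2 * K * C * suc L     ≡⟨ solve 3 (λ K C L → con 2 :* K :* C :* (con 1 :+ L) := con 2 :* C :* (K :* (con 1 :+ L)))
                                     refl K C L ⟩
    2 * C * (K * suc L)   ≤⟨ *-monoʳ-≤ (2 * C) K[1+L]≤ ⟩
    2 * C * (2 * m)       ≡⟨ solve 2 (λ C m → con 2 :* C :* (con 2 :* m) := con 4 :* C :* m) refl C m ⟩
    4 * C * m             ∎) L²≤ 4Cm<

⟦_⟧ : ℕ → ℚ
⟦ k ⟧ = + k / 1

fromℚᵘ-+ : ∀ p q → fromℚᵘ (p +ᵘ q) ≡ fromℚᵘ p +ℚ fromℚᵘ q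
fromℚᵘ-+ p q = sym (trans (sym (ℚₚ.fromℚᵘ-toℚᵘ (fromℚᵘ p +ℚ fromℚᵘ q)))
  (ℚₚ.fromℚᵘ-cong (ℚᵘₚ.≃-trans (ℚₚ.toℚᵘ-homo-+ (fromℚᵘ p) (fromℚᵘ q))
                               (ℚᵘₚ.+-cong (ℚₚ.toℚᵘ-fromℚᵘ p) (ℚₚ.toℚᵘ-fromℚᵘ q)))))

fromℚᵘ-* : ∀ p q → fromℚᵘ (p *ᵘ q) ≡ fromℚᵘ p *ℚ fromℚᵘ q
fromℚᵘ-* p q = sym (trans (sym (ℚₚ.fromℚᵘ-toℚᵘ (fromℚᵘ p *ℚ fromℚᵘ q)))
  (ℚₚ.fromℚᵘ-cong (ℚᵘₚ.≃-trans (ℚₚ.toℚᵘ-homo-* (fromℚᵘ p) (fromℚᵘ q))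
                               (ℚᵘₚ.*-cong (ℚₚ.toℚᵘ-fromℚᵘ p) (ℚₚ.toℚᵘ-fromℚᵘ q)))))

⟦+⟧ : ∀ a b → ⟦ a + b ⟧ ≡ ⟦ a ⟧ +ℚ ⟦ b ⟧
⟦+⟧ a b = trans (ℚₚ.fromℚᵘ-cong {mkℚᵘ (+ (a + b)) 0} {mkℚᵘ (+ a) 0 +ᵘ mkℚᵘ (+ b) 0} (*≡* same))
                (fromℚᵘ-+ (mkℚᵘ (+ a) 0) (mkℚᵘ (+ b) 0))
  where
  same : + (a + b) ℤ.* + 1 ≡ (+ a ℤ.* + 1 ℤ.+ + b ℤ.* + 1) ℤ.* + 1
  same rewrite ℤₚ.*-identityʳ (+ a) | ℤₚ.*-identityʳ (+ b) | ℤₚ.*-identityʳ (+ (a + b)) = refl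

⟦*⟧ : ∀ a b → ⟦ a * b ⟧ ≡ ⟦ a ⟧ *ℚ ⟦ b ⟧
⟦*⟧ a b = trans (ℚₚ.fromℚᵘ-cong {mkℚᵘ (+ (a * b)) 0} {mkℚᵘ (+ a) 0 *ᵘ mkℚᵘ (+ b) 0}
                                 (*≡* (cong (ℤ._* + 1) (ℤₚ.pos-* a b))))
                (fromℚᵘ-* (mkℚᵘ (+ a) 0) (mkℚᵘ (+ b) 0))

⟦≤⟧ : ∀ {a b} → a ≤ b → ⟦ a ⟧ ≤ℚ ⟦ b ⟧
⟦≤⟧ {a} {b} a≤b = ℚₚ.toℚᵘ-cancel-≤
  (ℚᵘₚ.≤-respˡ-≃ (ℚᵘₚ.≃-sym (ℚₚ.toℚᵘ-fromℚᵘ (mkℚᵘ (+ a) 0)))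
  (ℚᵘₚ.≤-respʳ-≃ (ℚᵘₚ.≃-sym (ℚₚ.toℚᵘ-fromℚᵘ (mkℚᵘ (+ b) 0)))
  (*≤* (subst₂ ℤ._≤_ (sym (ℤₚ.*-identityʳ (+ a))) (sym (ℤₚ.*-identityʳ (+ b))) (ℤ.+≤+ a≤b)))))

⟦∸⟧ : ∀ {a b} → b ≤ a → ⟦ a ⟧ -ℚ ⟦ b ⟧ ≡ ⟦ a ∸ b ⟧
⟦∸⟧ {a} {b} b≤a = begin
  ⟦ a ⟧ -ℚ ⟦ b ⟧             ≡⟨ cong (λ k → ⟦ k ⟧ -ℚ ⟦ b ⟧) (sym (m∸n+n≡m b≤a)) ⟩
  ⟦ a ∸ b + b ⟧ -ℚ ⟦ b ⟧     ≡⟨ cong (_-ℚ ⟦ b ⟧) (⟦+⟧ (a ∸ b) b) ⟩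
  ⟦ a ∸ b ⟧ +ℚ ⟦ b ⟧ -ℚ ⟦ b ⟧ ≡⟨ solve 2 (λ x y → x :+ y :- y := x) refl ⟦ a ∸ b ⟧ ⟦ b ⟧ ⟩
  ⟦ a ∸ b ⟧                  ∎
  where
  open ≡-Reasoning
  open ℚSolver.+-*-Solver using (solve; _:=_; _:+_; _:*_; _:-_; con)

/-as-* : ∀ a m .{{_ : NonZero m}} → + a / m ≡ ⟦ a ⟧ *ℚ (+ 1 / m)
/-as-* a (suc m) = trans (ℚₚ.fromℚᵘ-cong {mkℚᵘ (+ a) m} {mkℚᵘ (+ a) 0 *ᵘ mkℚᵘ (+ 1) m} (*≡* same))
                         (fromℚᵘ-* (mkℚᵘ (+ a) 0) (mkℚᵘ (+ 1) m))
  where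
  same : + a ℤ.* + suc (m + 0) ≡ (+ a ℤ.* + 1) ℤ.* + suc m
  same rewrite +-identityʳ m | ℤₚ.*-identityʳ (+ a) = refl

⟦m⟧*1/m≡1 : ∀ m .{{_ : NonZero m}} → ⟦ m ⟧ *ℚ (+ 1 / m) ≡ 1ℚ
⟦m⟧*1/m≡1 (suc m) = trans (sym (/-as-* (suc m) (suc m)))
  (ℚₚ.fromℚᵘ-cong {mkℚᵘ (+ suc m) m} {mkℚᵘ (+ 1) 0} (*≡* (ℤₚ.*-comm (+ suc m) (+ 1))))

4*¼≡1 : ⟦ 4 ⟧ *ℚ (+ 1 / 4) ≡ 1ℚ
4*¼≡1 = refl

64*¼*¼≡4 : ⟦ 64 ⟧ *ℚ (+ 1 / 4) *ℚ (+ 1 / 4) ≡ ⟦ 4 ⟧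
64*¼*¼≡4 = refl

p≤q⇒p-q≤0 : ∀ {p q} → p ≤ℚ q → p -ℚ q ≤ℚ 0ℚ
p≤q⇒p-q≤0 {p} {q} p≤q = ℚₚ.≤-trans (ℚₚ.+-monoˡ-≤ (-ℚ q) p≤q) (ℚₚ.≤-reflexive (ℚₚ.+-inverseʳ q))

-- 1 − E/m − q for a partition with P internal edges and Σ vol(A)² = Q.
deficit : ∀ m .{{_ : NonZero m}} → ℕ → ℕ → ℕ → ℚ
deficit m E P Q =
  (1ℚ -ℚ (+ E / m)) -ℚ ((+ 1 / m) *ℚ (+ P / 1) -ℚ (+ 1 / 4) *ℚ (+ 1 / m) *ℚ (+ 1 / m) *ℚ (+ Q / 1))

scale : ∀ m .{{_ : NonZero m}} → ℚ
scale m = (+ 1 / 4) *ℚ (+ 1 / m) *ℚ (+ 1 / m)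

scale-nonNeg : ∀ m .{{_ : NonZero m}} → ℚ.NonNegative (scale m)
scale-nonNeg m =
  ℚₚ.nonNeg*nonNeg⇒nonNeg ((+ 1 / 4) *ℚ (+ 1 / m))
    {{ℚₚ.nonNeg*nonNeg⇒nonNeg (+ 1 / 4) {{ℚₚ.normalize-nonNeg 1 4}} (+ 1 / m) {{ℚₚ.normalize-nonNeg 1 m}}}}
    (+ 1 / m) {{ℚₚ.normalize-nonNeg 1 m}}

-- The identities below are polynomial in 4 · ¼ and m · (1/m), which are then replaced by 1.
deficit≡ : ∀ m .{{_ : NonZero m}} E P Q →
  deficit m E P Q ≡ (⟦ 4 * m * m + Q ⟧ -ℚ ⟦ 4 * m * (P + E) ⟧) *ℚ scale m
deficit≡ m E P Q = sym (begin
  (⟦ 4 * m * m + Q ⟧ -ℚ ⟦ 4 * m * (P + E) ⟧) *ℚ scale m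
    ≡⟨ cong₂ (λ x y → (x -ℚ y) *ℚ scale m) ⟦4mm+Q⟧ ⟦4m[P+E]⟧ ⟩
  ((⟦ 4 ⟧ *ℚ ⟦ m ⟧ *ℚ ⟦ m ⟧ +ℚ ⟦ Q ⟧) -ℚ ⟦ 4 ⟧ *ℚ ⟦ m ⟧ *ℚ (⟦ P ⟧ +ℚ ⟦ E ⟧)) *ℚ scale m
    ≡⟨ solve 7 (λ f M Q P E c r → ((f :* M :* M :+ Q) :- f :* M :* (P :+ E)) :* (c :* r :* r)
                  := (f :* c) :* (M :* r) :* (M :* r) :+ c :* r :* r :* Q :- (f :* c) :* (M :* r) :* r :* (P :+ E))
               refl ⟦ 4 ⟧ ⟦ m ⟧ ⟦ Q ⟧ ⟦ P ⟧ ⟦ E ⟧ (+ 1 / 4) r ⟩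
  poly (⟦ 4 ⟧ *ℚ (+ 1 / 4)) (⟦ m ⟧ *ℚ r)
    ≡⟨ cong₂ poly 4*¼≡1 (⟦m⟧*1/m≡1 m) ⟩
  poly 1ℚ 1ℚ
    ≡⟨ solve 5 (λ Q P E c r → con 1ℚ :* con 1ℚ :* con 1ℚ :+ c :* r :* r :* Q
                                :- con 1ℚ :* con 1ℚ :* r :* (P :+ E)
                  := (con 1ℚ :- E :* r) :- (r :* P :- c :* r :* r :* Q))
               refl ⟦ Q ⟧ ⟦ P ⟧ ⟦ E ⟧ (+ 1 / 4) r ⟩
  (1ℚ -ℚ ⟦ E ⟧ *ℚ r) -ℚ (r *ℚ ⟦ P ⟧ -ℚ (+ 1 / 4) *ℚ r *ℚ r *ℚ ⟦ Q ⟧)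
    ≡⟨ cong (λ x → (1ℚ -ℚ x) -ℚ (r *ℚ ⟦ P ⟧ -ℚ (+ 1 / 4) *ℚ r *ℚ r *ℚ ⟦ Q ⟧))
            (sym (/-as-* E m)) ⟩
  deficit m E P Q ∎)
  where
  open ≡-Reasoning
  open ℚSolver.+-*-Solver using (solve; _:=_; _:+_; _:*_; _:-_; con)
  r : ℚ
  r = + 1 / m
  ⟦4m⟧ : ⟦ 4 * m ⟧ ≡ ⟦ 4 ⟧ *ℚ ⟦ m ⟧
  ⟦4m⟧ = ⟦*⟧ 4 m
  ⟦4mm+Q⟧ : ⟦ 4 * m * m + Q ⟧ ≡ ⟦ 4 ⟧ *ℚ ⟦ m ⟧ *ℚ ⟦ m ⟧ +ℚ ⟦ Q ⟧
  ⟦4mm+Q⟧ = trans (⟦+⟧ (4 * m * m) Q) (cong (_+ℚ ⟦ Q ⟧) (trans (⟦*⟧ (4 * m) m) (cong (_*ℚ ⟦ m ⟧) ⟦4m⟧)))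
  ⟦4m[P+E]⟧ : ⟦ 4 * m * (P + E) ⟧ ≡ ⟦ 4 ⟧ *ℚ ⟦ m ⟧ *ℚ (⟦ P ⟧ +ℚ ⟦ E ⟧)
  ⟦4m[P+E]⟧ = trans (⟦*⟧ (4 * m) (P + E)) (cong₂ _*ℚ_ ⟦4m⟧ (⟦+⟧ P E))
  poly : ℚ → ℚ → ℚ
  poly w u = w *ℚ u *ℚ u +ℚ (+ 1 / 4) *ℚ r *ℚ r *ℚ ⟦ Q ⟧ -ℚ w *ℚ u *ℚ r *ℚ (⟦ P ⟧ +ℚ ⟦ E ⟧)

⟦64Cm³⟧*scale² : ∀ m .{{_ : NonZero m}} C →
  ⟦ 64 * C * m * m * m ⟧ *ℚ (scale m *ℚ scale m) ≡ ⟦ 4 ⟧ *ℚ (+ C / m)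
⟦64Cm³⟧*scale² m C = begin
  ⟦ 64 * C * m * m * m ⟧ *ℚ (scale m *ℚ scale m)
    ≡⟨ cong (_*ℚ (scale m *ℚ scale m)) ⟦64Cmmm⟧ ⟩
  ⟦ 64 ⟧ *ℚ ⟦ C ⟧ *ℚ ⟦ m ⟧ *ℚ ⟦ m ⟧ *ℚ ⟦ m ⟧ *ℚ (scale m *ℚ scale m)
    ≡⟨ solve 5 (λ f C M c r → f :* C :* M :* M :* M :* ((c :* r :* r) :* (c :* r :* r))
                  := (f :* c :* c) :* (M :* r) :* (M :* r) :* (M :* r) :* (C :* r))
               refl ⟦ 64 ⟧ ⟦ C ⟧ ⟦ m ⟧ (+ 1 / 4) r ⟩
  poly (⟦ 64 ⟧ *ℚ (+ 1 / 4) *ℚ (+ 1 / 4)) (⟦ m ⟧ *ℚ r)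
    ≡⟨ cong₂ poly 64*¼*¼≡4 (⟦m⟧*1/m≡1 m) ⟩
  poly ⟦ 4 ⟧ 1ℚ
    ≡⟨ solve 3 (λ f C r → f :* con 1ℚ :* con 1ℚ :* con 1ℚ :* (C :* r) := f :* (C :* r))
               refl ⟦ 4 ⟧ ⟦ C ⟧ r ⟩
  ⟦ 4 ⟧ *ℚ (⟦ C ⟧ *ℚ r)
    ≡⟨ cong (⟦ 4 ⟧ *ℚ_) (sym (/-as-* C m)) ⟩
  ⟦ 4 ⟧ *ℚ (+ C / m) ∎
  where
  open ≡-Reasoning
  open ℚSolver.+-*-Solver using (solve; _:=_; _:+_; _:*_; _:-_; con)
  r : ℚ
  r = + 1 / m
  ⟦64Cm⟧ : ⟦ 64 * C * m ⟧ ≡ ⟦ 64 ⟧ *ℚ ⟦ C ⟧ *ℚ ⟦ m ⟧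
  ⟦64Cm⟧ = trans (⟦*⟧ (64 * C) m) (cong (_*ℚ ⟦ m ⟧) (⟦*⟧ 64 C))
  ⟦64Cmmm⟧ : ⟦ 64 * C * m * m * m ⟧ ≡ ⟦ 64 ⟧ *ℚ ⟦ C ⟧ *ℚ ⟦ m ⟧ *ℚ ⟦ m ⟧ *ℚ ⟦ m ⟧
  ⟦64Cmmm⟧ = trans (⟦*⟧ (64 * C * m * m) m)
                   (cong (_*ℚ ⟦ m ⟧) (trans (⟦*⟧ (64 * C * m) m) (cong (_*ℚ ⟦ m ⟧) ⟦64Cm⟧)))
  poly : ℚ → ℚ → ℚ
  poly w u = w *ℚ u *ℚ u *ℚ u *ℚ (⟦ C ⟧ *ℚ r)

modularity-deficit-bound : ∀ m .{{_ : NonZero m}} E P Q C L K →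
  m ≤ P + E + K * C → Q ≤ L * (2 * m) → K * suc L ≤ 2 * m →
  L * L ≤ 4 * C * m → 4 * C * m < suc L * suc L →
  LeTwoSqrt (deficit m E P Q) (+ C / m)
modularity-deficit-bound m E P Q C L K m≤ Q≤ K[1+L]≤ L²≤ 4Cm< with 4 * m * m + Q ≤? 4 * m * (P + E)
... | yes A≤B = inj₁ (begin
  deficit m E P Q
    ≡⟨ deficit≡ m E P Q ⟩
  (⟦ 4 * m * m + Q ⟧ -ℚ ⟦ 4 * m * (P + E) ⟧) *ℚ scale m
    ≤⟨ ℚₚ.*-monoʳ-≤-nonNeg (scale m) {{scale-nonNeg m}} (p≤q⇒p-q≤0 (⟦≤⟧ A≤B)) ⟩
  0ℚ *ℚ scale m
    ≡⟨ ℚₚ.*-zeroˡ (scale m) ⟩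
  0ℚ ∎)
  where open ℚₚ.≤-Reasoning
... | no A≰B = inj₂ (begin
  deficit m E P Q *ℚ deficit m E P Q
    ≡⟨ cong (λ x → x *ℚ x) (trans (deficit≡ m E P Q) (cong (_*ℚ s) (⟦∸⟧ B≤A))) ⟩
  (⟦ z ⟧ *ℚ s) *ℚ (⟦ z ⟧ *ℚ s)
    ≡⟨ solve 2 (λ x y → (x :* y) :* (x :* y) := (x :* x) :* (y :* y)) refl ⟦ z ⟧ s ⟩
  ⟦ z ⟧ *ℚ ⟦ z ⟧ *ℚ (s *ℚ s)
    ≡⟨ cong (_*ℚ (s *ℚ s)) (sym (⟦*⟧ z z)) ⟩
  ⟦ z * z ⟧ *ℚ (s *ℚ s)
    ≤⟨ ℚₚ.*-monoʳ-≤-nonNeg (s *ℚ s) {{ℚₚ.nonNeg*nonNeg⇒nonNeg s {{scale-nonNeg m}} s {{scale-nonNeg m}}}}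
         (⟦≤⟧ (deficit-numerator-bound m E P Q C L K m≤ Q≤ K[1+L]≤ L²≤ 4Cm< z
                                       (≤-reflexive (m∸n+n≡m B≤A)))) ⟩
  ⟦ 64 * C * m * m * m ⟧ *ℚ (s *ℚ s)
    ≡⟨ ⟦64Cm³⟧*scale² m C ⟩
  ⟦ 4 ⟧ *ℚ (+ C / m) ∎)
  where
  open ℚₚ.≤-Reasoning
  open ℚSolver.+-*-Solver using (solve; _:=_; _:*_)
  s : ℚ
  s = scale m
  B≤A : 4 * m * (P + E) ≤ 4 * m * m + Q
  B≤A = <⇒≤ (≰⇒> A≰B)
  z : ℕ
  z = 4 * m * m + Q ∸ 4 * m * (P + E)

maxDegree²≤ : ∀ {n} (G : Graph n) t →
  maxDegree (adj G) * maxDegree (adj G) ≤ 4 * (suc t * maxDegree (adj G)) * numEdges (adj G)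
maxDegree²≤ G t = begin
  Δ * Δ                     ≤⟨ *-monoʳ-≤ Δ Δ≤2m ⟩
  Δ * (2 * m)               ≤⟨ m≤m*n (Δ * (2 * m)) (2 * suc t) ⟩
  Δ * (2 * m) * (2 * suc t) ≡⟨ solve 3 (λ Δ m t → Δ :* (con 2 :* m) :* (con 2 :* (con 1 :+ t))
                                               := con 4 :* ((con 1 :+ t) :* Δ) :* m) refl Δ m t ⟩
  4 * (suc t * Δ) * m       ∎
  where
  open ≤-Reasoning
  open ℕSolver.+-*-Solver
  Δ m : ℕ
  Δ = maxDegree (adj G)
  m = numEdges (adj G)
  Δ≤2m : Δ ≤ 2 * m
  Δ≤2m = ≤-trans (maxFin≤sumFin (degree (adj G))) (≤-reflexive (degree-sum G))

theorem1p11 : ∀ {n : ℕ} (G : Graph n) {{_ : NonZero (numEdges (adj G))}}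
    (E' : Fin n → Fin n → Bool) →
    (∀ i j → E' i j ≡ E' j i) →
    (∀ i j → E' i j ≡ true → adj G i j ≡ true) →
    (t : ℕ) → TreewidthAtMost (deleteEdges (adj G) E') t →
    ∃ λ (k : ℕ) → ∃ λ (c : Fin n → Fin k) →
      LeTwoSqrt ((1ℚ -ℚ (+ numEdges E' / numEdges (adj G))) -ℚ modularityOf G c)
                (+ (suc t * maxDegree (adj G)) / numEdges (adj G))
theorem1p11 G E' E'-sym _ t TD =
  _ , labelling ,
  modularity-deficit-bound m (numEdges E') internalEdges _ C L cutSize
    edges-accounted vol²-bound cutSize-bound L²≤4Cm 4Cm<[1+L]²
  where
  m C : ℕ
  m = numEdges (adj G)
  C = suc t * maxDegree (adj G)
  L : ℕ
  L = proj₁ (integer-sqrt (4 * C * m))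
  L²≤4Cm : L * L ≤ 4 * C * m
  L²≤4Cm = proj₁ (proj₂ (integer-sqrt (4 * C * m)))
  4Cm<[1+L]² : 4 * C * m < suc L * suc L
  4Cm<[1+L]² = proj₂ (proj₂ (integer-sqrt (4 * C * m)))
  open CutPartition G E' E'-sym t TD L (≤-integer-sqrt (maxDegree²≤ G t) 4Cm<[1+L]²)
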